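{- Let $T=(K,L,R)$ and let $(b_T(n))_{n\in\mathbb N_0}$ be any sequence associated with $T$. Let $p$ be a prime with $2\le p\le\underline{\deg}\,K-u+1$ such that $p\nmid r$ and $p\nmid r_u$, where $r=\sum_{j=0}^u r_j$. Assume that all but finitely many values $b_T(n)$ are divisible by $p$, and that $k_{n+u-t}\ge n$ for every $n\in\mathbb N_0$. Then one of the following holds: (1) $p\mid b_T(n)$ for every $n\in\mathbb N_0$; (2) if $n_0$ is the largest integer with $p\nmid b_T(n_0)$, then $n_0=k_{n_0+u-t}$ and $l_t\equiv r_u\pmod p$.
   Context: Let $K=(k_n)_{n\in\mathbb N_0}$ be a strictly increasing sequence of non-negative integers with $k_0=0$; set $k_{ -n}=-n$ for $n\in\mathbb N$. Let $L=(l_0,\dots,l_t)$ and $R=(r_0,\dots,r_u)$ be finite sequences of integers and $T=(K,L,R)$. A sequence of integers $(b_T(n))_{n\in\mathbb N_0}$, extended by $b_T(q)=0$ for negative integers $q$, is associated with $T$ if for every $n\in\mathbb N_0$: (a) $b_T(k_n)=b_T(k_n+1)=\dots=b_T(k_{n+1}-1)$, and (b) $\sum_{i=0}^{t}l_ib_T(k_{n-i})=\sum_{j=0}^{u}r_jb_T(n-j)$ (initial values are otherwise arbitrary). The lower degree of $K$ is $\underline{\deg}\,K=\inf\{d\in\mathbb N:\ k_n-k_{n-1}=d \text{ for infinitely many } n\}$. -}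

module Defs where

open import Data.Nat as ℕ using (ℕ; zero; suc)
open import Data.Integer as ℤ using (ℤ; +_; -[1+_]; 0ℤ; _+_; _*_; _-_)
open import Data.Integer.Divisibility using (_∣_)
open import Data.Fin using (Fin; toℕ; fromℕ)
import Data.Fin as Fin
open import Data.Product using (Σ; ∃; _×_; _,_)
open import Relation.Binary.PropositionalEquality using (_≡_)
open import Relation.Nullary using (¬_)

sumFin : ∀ {m} → (Fin m → ℤ) → ℤ
sumFin {zero}  f = 0ℤ
sumFin {suc m} f = f Fin.zero + sumFin (λ i → f (Fin.suc i))

IsKSeq : (ℕ → ℕ) → Set
IsKSeq K = (K 0 ≡ 0) × (∀ n → K n ℕ.< K (suc n))

kZ : (ℕ → ℕ) → ℤ → ℤ
kZ K (+ n)     = + K n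
kZ K -[1+ m ]  = -[1+ m ]

bZ : (ℕ → ℤ) → ℤ → ℤ
bZ b (+ n)    = b n
bZ b -[1+ m ] = 0ℤ

Associated : (K : ℕ → ℕ) (t u : ℕ) (L : Fin (suc t) → ℤ) (R : Fin (suc u) → ℤ)
             (b : ℕ → ℤ) → Set
Associated K t u L R b =
  (∀ n m → K n ℕ.≤ m → m ℕ.< K (suc n) → b m ≡ b (K n))
  × (∀ n → sumFin (λ i → L i * bZ b (kZ K (+ n - + toℕ i)))
           ≡ sumFin (λ j → R j * bZ b (+ n - + toℕ j)))

-- "d occurs infinitely often as a gap k_n - k_{n-1}" (n ≥ 1; the single
-- gap k_0 - k_{-1} = 1 is irrelevant for "infinitely many")
InfOftenGap : (ℕ → ℕ) → ℕ → Set
InfOftenGap K d = ∀ N → ∃ λ n → N ℕ.≤ n × (K (suc n) ℕ.∸ K n ≡ d)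

-- c ≤ lower degree of K, where lowerdeg K = inf {d ∈ ℕ : InfOftenGap K d}
-- (inf ∅ = ∞); c ≤ inf S  iff  c ≤ d for every d ∈ S.
LowerDegGE : (ℕ → ℕ) → ℕ → Set
LowerDegGE K c = ∀ d → 1 ℕ.≤ d → InfOftenGap K d → c ℕ.≤ d

{-# OPTIONS --safe #-}
-- Apply the recurrence at n = n₀ + u, where n₀ is the last index with p ∤ b n₀.
-- Every term other than l_t b(k_{n₀+u-t}) and r_u b(n₀) evaluates b at an index
-- beyond n₀: on the right because n₀ + u - j > n₀ for j < u, on the left because K
-- is strictly increasing and k_{n₀+u-t} ≥ n₀. Hence l_t b(k_{n₀+u-t}) ≡ r_u b(n₀)
-- (mod p), and the right side is a unit mod p. So b(k_{n₀+u-t}) ≢ 0, which forces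
-- k_{n₀+u-t} = n₀, and then (l_t - r_u) b(n₀) ≡ 0 gives p ∣ l_t - r_u.
module Submission where

open import Defs
open import Data.Nat as ℕ using (ℕ; suc)
open import Data.Nat.Primality using (Prime)
open import Data.Integer as ℤ using (ℤ; +_; _-_)
open import Data.Integer.Divisibility using (_∣_)
open import Data.Fin using (Fin; fromℕ)
open import Data.Product using (Σ; ∃; _×_; _,_)
open import Data.Sum using (_⊎_)
open import Relation.Binary.PropositionalEquality using (_≡_)
open import Relation.Nullary using (¬_)

open import Data.Nat.Primality using (euclidsLemma)
open import Data.Integer using (-[1+_])
import Data.Nat.Properties as NP
import Data.Nat.Divisibility as ND
import Data.Integer.Properties as ZP
open import Data.Integer.Divisibility.Signed
  using (∣ᵤ⇒∣; ∣⇒∣ᵤ; ∣m∣n⇒∣m+n; ∣m∣n⇒∣m-n; ∣m⇒∣-m; ∣n⇒∣m*n; ∣m+n∣m⇒∣n)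
  renaming (_∣_ to _∣ˢ_)
open import Data.Integer.Tactic.RingSolver using (solve-∀)
open import Data.Fin using (toℕ)
import Data.Fin as Fin
open import Data.Fin.Properties using (toℕ-fromℕ)
open import Data.Product using (proj₁; proj₂)
open import Data.Sum using (inj₁; inj₂; [_,_]′)
open import Data.Empty using (⊥-elim)
open import Function using (id)
open import Relation.Nullary using (yes; no)
open import Relation.Unary using (Decidable)
open import Relation.Binary.PropositionalEquality using (refl; sym; trans; cong; subst)

stepwise<⇒strictMono : {f : ℕ → ℕ} → (∀ n → f n ℕ.< f (suc n)) →
                       ∀ {m n} → m ℕ.< n → f m ℕ.< f n
stepwise<⇒strictMono {f} f↑ m<n = go (NP.≤⇒≤′ m<n)
  where
  go : ∀ {m n} → suc m ℕ.≤′ n → f m ℕ.< f n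
  go ℕ.≤′-refl      = f↑ _
  go (ℕ.≤′-step m<n) = NP.<-trans (go m<n) (f↑ _)

eventually⇒always⊎lastFailure : {P : ℕ → Set} → Decidable P → ∀ N →
                                (∀ n → N ℕ.≤ n → P n) →
                                (∀ n → P n) ⊎ ∃ λ n₀ → ¬ P n₀ × (∀ m → n₀ ℕ.< m → P m)
eventually⇒always⊎lastFailure P? ℕ.zero  eventually = inj₁ (λ n → eventually n ℕ.z≤n)
eventually⇒always⊎lastFailure {P} P? (suc N) eventually with P? N
... | no ¬PN = inj₂ (N , ¬PN , eventually)
... | yes PN = eventually⇒always⊎lastFailure P? N fromN
  where
  fromN : ∀ n → N ℕ.≤ n → P n
  fromN n N≤n with NP.m≤n⇒m<n∨m≡n N≤n
  ... | inj₁ N<n  = eventually n N<n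
  ... | inj₂ refl = PN

+m-+n≡+[m∸n] : ∀ {m n} → n ℕ.≤ m → + m - + n ≡ + (m ℕ.∸ n)
+m-+n≡+[m∸n] {m} {n} n≤m = trans (ZP.m-n≡m⊖n m n) (ZP.⊖-≥ n≤m)

prime∣*⇒∣⊎∣ : ∀ {p} → Prime p → ∀ i j → + p ∣ i ℤ.* j → + p ∣ i ⊎ + p ∣ j
prime∣*⇒∣⊎∣ {p} p-prime i j p∣ij =
  euclidsLemma ℤ.∣ i ∣ ℤ.∣ j ∣ p-prime (subst (p ND.∣_) (ZP.abs-* i j) p∣ij)

prime∤* : ∀ {p i j} → Prime p → ¬ + p ∣ i → ¬ + p ∣ j → ¬ + p ∣ i ℤ.* j
prime∤* {i = i} {j} p-prime p∤i p∤j p∣ij = [ p∤i , p∤j ]′ (prime∣*⇒∣⊎∣ p-prime i j p∣ij)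

∣m-n∣m⇒∣n : ∀ {q m n} → q ∣ˢ m - n → q ∣ˢ m → q ∣ˢ n
∣m-n∣m⇒∣n {q} {n = n} q∣m-n q∣m =
  subst (q ∣ˢ_) (ZP.neg-involutive n) (∣m⇒∣-m (∣m+n∣m⇒∣n q∣m-n q∣m))

∣m-n∣m-o⇒∣o-n : ∀ {q} m n o → q ∣ˢ m - n → q ∣ˢ m - o → q ∣ˢ o - n
∣m-n∣m-o⇒∣o-n {q} m n o q∣m-n q∣m-o =
  subst (q ∣ˢ_) (telescope m n o) (∣m∣n⇒∣m-n q∣m-n q∣m-o)
  where
  telescope : ∀ m n o → (m - n) - (m - o) ≡ o - n
  telescope = solve-∀

∣sumFin-last : ∀ {q} m (f : Fin (suc m) → ℤ) → (∀ i → toℕ i ℕ.< m → q ∣ˢ f i) →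
               q ∣ˢ sumFin f - f (fromℕ m)
∣sumFin-last {q} ℕ.zero f _ =
  subst (q ∣ˢ_) (sym (cancel (f Fin.zero))) (∣ᵤ⇒∣ (ℤ.∣ q ∣ ND.∣0))
  where
  cancel : ∀ x → (x ℤ.+ ℤ.0ℤ) - x ≡ ℤ.0ℤ
  cancel = solve-∀
∣sumFin-last {q} (suc m) f q∣f =
  subst (q ∣ˢ_) (sym (ZP.+-assoc (f Fin.zero) _ _))
    (∣m∣n⇒∣m+n (q∣f Fin.zero (ℕ.s≤s ℕ.z≤n))
      (∣sumFin-last m (λ i → f (Fin.suc i)) (λ i i<m → q∣f (Fin.suc i) (ℕ.s≤s i<m))))

m*o-n*o≡[m-n]*o : ∀ m n o → m ℤ.* o - n ℤ.* o ≡ (m - n) ℤ.* o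
m*o-n*o≡[m-n]*o = solve-∀

∣m*x-n*y⇒∤x : ∀ {p} m n x y → Prime p → ¬ + p ∣ n → ¬ + p ∣ y →
              + p ∣ˢ m ℤ.* x - n ℤ.* y → ¬ + p ∣ x
∣m*x-n*y⇒∤x {p} m n x y p-prime p∤n p∤y p∣mx-ny p∣x =
  prime∤* {i = n} p-prime p∤n p∤y
    (∣⇒∣ᵤ {+ p} {n ℤ.* y} (∣m-n∣m⇒∣n p∣mx-ny (∣n⇒∣m*n m (∣ᵤ⇒∣ p∣x))))

∣m*x-n*x⇒∣m-n : ∀ {p} m n x → Prime p → ¬ + p ∣ x →
                + p ∣ˢ m ℤ.* x - n ℤ.* x → + p ∣ m - n
∣m*x-n*x⇒∣m-n {p} m n x p-prime p∤x p∣mx-nx =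
  [ id , (λ p∣x → ⊥-elim (p∤x p∣x)) ]′ (prime∣*⇒∣⊎∣ p-prime (m - n) x
    (∣⇒∣ᵤ {+ p} {(m - n) ℤ.* x} (subst (+ p ∣ˢ_) (m*o-n*o≡[m-n]*o m n x) p∣mx-nx)))

+≤kZ⇒0≤ : ∀ (K : ℕ → ℕ) {n} z → + n ℤ.≤ kZ K z → ℤ.0ℤ ℤ.≤ z
+≤kZ⇒0≤ K (+ m)    _ = ℤ.+≤+ ℕ.z≤n
+≤kZ⇒0≤ K -[1+ m ] ()

+≤kZ[m-n]⇒n≤m×≤K[m∸n] : ∀ K {k m n} → + k ℤ.≤ kZ K (+ m - + n) →
                         n ℕ.≤ m × k ℕ.≤ K (m ℕ.∸ n)
+≤kZ[m-n]⇒n≤m×≤K[m∸n] K {k} {m} {n} k≤ =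
  n≤m , ZP.drop‿+≤+ (subst (λ z → + k ℤ.≤ kZ K z) (+m-+n≡+[m∸n] n≤m) k≤)
  where
  n≤m : n ℕ.≤ m
  n≤m = ZP.drop‿+≤+ (ZP.0≤i-j⇒j≤i (+≤kZ⇒0≤ K _ k≤))

module _ {K : ℕ → ℕ} (K↑ : ∀ n → K n ℕ.< K (suc n))
         {t u : ℕ} {L : Fin (suc t) → ℤ} {R : Fin (suc u) → ℤ} {b : ℕ → ℤ}
         (recurrence : ∀ n → sumFin (λ i → L i ℤ.* bZ b (kZ K (+ n - + toℕ i)))
                             ≡ sumFin (λ j → R j ℤ.* bZ b (+ n - + toℕ j)))
  where

  leadingTerms-congruent : ∀ {q} n₀ → t ℕ.≤ n₀ ℕ.+ u → n₀ ℕ.≤ K (n₀ ℕ.+ u ℕ.∸ t) →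
                           (∀ m → n₀ ℕ.< m → q ∣ˢ b m) →
                           q ∣ˢ L (fromℕ t) ℤ.* b (K (n₀ ℕ.+ u ℕ.∸ t)) - R (fromℕ u) ℤ.* b n₀
  leadingTerms-congruent {q} n₀ t≤n n₀≤kₙ₋ₜ tail =
    subst (λ x → q ∣ˢ x - R (fromℕ u) ℤ.* b n₀) lastL
      (subst (λ y → q ∣ˢ L-term (fromℕ t) - y) lastR
        (∣m-n∣m-o⇒∣o-n (sumFin R-term) (R-term (fromℕ u)) (L-term (fromℕ t))
          (∣sumFin-last u R-term R-term-divisible)
          (subst (λ s → q ∣ˢ s - L-term (fromℕ t)) (recurrence n)
            (∣sumFin-last t L-term L-term-divisible))))
    where
    n : ℕ
    n = n₀ ℕ.+ u

    L-term : Fin (suc t) → ℤ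
    L-term i = L i ℤ.* bZ b (kZ K (+ n - + toℕ i))

    R-term : Fin (suc u) → ℤ
    R-term j = R j ℤ.* bZ b (+ n - + toℕ j)

    L-term≡ : ∀ i {k} → toℕ i ≡ k → k ℕ.≤ n → L-term i ≡ L i ℤ.* b (K (n ℕ.∸ k))
    L-term≡ i refl k≤n = cong (λ z → L i ℤ.* bZ b (kZ K z)) (+m-+n≡+[m∸n] k≤n)

    R-term≡ : ∀ j {k} → toℕ j ≡ k → k ℕ.≤ n → R-term j ≡ R j ℤ.* b (n ℕ.∸ k)
    R-term≡ j refl k≤n = cong (λ z → R j ℤ.* bZ b z) (+m-+n≡+[m∸n] k≤n)

    L-term-divisible : ∀ i → toℕ i ℕ.< t → q ∣ˢ L-term i
    L-term-divisible i i<t =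
      subst (q ∣ˢ_) (sym (L-term≡ i refl (NP.≤-trans (NP.<⇒≤ i<t) t≤n)))
        (∣n⇒∣m*n (L i) (tail _ (NP.≤-<-trans n₀≤kₙ₋ₜ
          (stepwise<⇒strictMono K↑ (NP.∸-monoʳ-< i<t t≤n)))))

    R-term-divisible : ∀ j → toℕ j ℕ.< u → q ∣ˢ R-term j
    R-term-divisible j j<u =
      subst (q ∣ˢ_) (sym (R-term≡ j refl (NP.≤-trans (NP.<⇒≤ j<u) (NP.m≤n+m u n₀))))
        (∣n⇒∣m*n (R j) (tail _ n₀<n∸j))
      where
      n₀<n∸j : n₀ ℕ.< n ℕ.∸ toℕ j
      n₀<n∸j = subst (n₀ ℕ.<_) (sym (NP.+-∸-assoc n₀ (NP.<⇒≤ j<u)))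
                 (NP.m<m+n n₀ (NP.m<n⇒0<n∸m j<u))

    lastL : L-term (fromℕ t) ≡ L (fromℕ t) ℤ.* b (K (n ℕ.∸ t))
    lastL = L-term≡ (fromℕ t) (toℕ-fromℕ t) t≤n

    lastR : R-term (fromℕ u) ≡ R (fromℕ u) ℤ.* b n₀
    lastR = trans (R-term≡ (fromℕ u) (toℕ-fromℕ u) (NP.m≤n+m u n₀))
                  (cong (λ m → R (fromℕ u) ℤ.* b m) (NP.m+n∸n≡m n₀ u))

lemma1 : (K : ℕ → ℕ) (t u : ℕ) (L : Fin (suc t) → ℤ) (R : Fin (suc u) → ℤ)
         (b : ℕ → ℤ) (p : ℕ) →
         IsKSeq K →
         Associated K t u L R b →
         Prime p → 2 ℕ.≤ p →
         LowerDegGE K (p ℕ.+ u ℕ.∸ 1) →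
         ¬ (+ p ∣ sumFin R) →
         ¬ (+ p ∣ R (fromℕ u)) →
         (∃ λ N → ∀ n → N ℕ.≤ n → + p ∣ b n) →
         (∀ n → + n ℤ.≤ kZ K (+ n ℤ.+ + u - + t)) →
         (∀ n → + p ∣ b n)
         ⊎ (∃ λ n₀ → ¬ (+ p ∣ b n₀) × (∀ m → n₀ ℕ.< m → + p ∣ b m)
                    × (kZ K (+ n₀ ℤ.+ + u - + t) ≡ + n₀)
                    × (+ p ∣ (L (fromℕ t) - R (fromℕ u))))
lemma1 K t u L R b p (_ , K↑) (_ , recurrence) p-prime _ _ _ p∤Rᵤ (N , eventually) k-bound
  with eventually⇒always⊎lastFailure (λ n → p ND.∣? ℤ.∣ b n ∣) N eventually
... | inj₁ always = inj₁ always
... | inj₂ (n₀ , p∤b₀ , tail) = inj₂ (n₀ , p∤b₀ , tail , k≡n₀ , p∣Lₜ-Rᵤ)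
  where
  c : ℕ
  c = n₀ ℕ.+ u ℕ.∸ t

  Lₜ Rᵤ : ℤ
  Lₜ = L (fromℕ t)
  Rᵤ = R (fromℕ u)

  bounds : t ℕ.≤ n₀ ℕ.+ u × n₀ ℕ.≤ K c
  bounds = +≤kZ[m-n]⇒n≤m×≤K[m∸n] K (k-bound n₀)

  congruence : + p ∣ˢ Lₜ ℤ.* b (K c) - Rᵤ ℤ.* b n₀
  congruence = leadingTerms-congruent K↑ {L = L} {R} {b} recurrence n₀
                 (proj₁ bounds) (proj₂ bounds) (λ m n₀<m → ∣ᵤ⇒∣ (tail m n₀<m))

  kc≡n₀ : K c ≡ n₀
  kc≡n₀ with NP.m≤n⇒m<n∨m≡n (proj₂ bounds)
  ... | inj₂ n₀≡kc = sym n₀≡kc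
  ... | inj₁ n₀<kc = ⊥-elim (∣m*x-n*y⇒∤x Lₜ Rᵤ (b (K c)) (b n₀) p-prime p∤Rᵤ p∤b₀
                               congruence (tail (K c) n₀<kc))

  k≡n₀ : kZ K (+ n₀ ℤ.+ + u - + t) ≡ + n₀
  k≡n₀ = trans (cong (kZ K) (+m-+n≡+[m∸n] (proj₁ bounds))) (cong +_ kc≡n₀)

  p∣Lₜ-Rᵤ : + p ∣ Lₜ - Rᵤ
  p∣Lₜ-Rᵤ = ∣m*x-n*x⇒∣m-n Lₜ Rᵤ (b n₀) p-prime p∤b₀
              (subst (λ m → + p ∣ˢ Lₜ ℤ.* b m - Rᵤ ℤ.* b n₀) kc≡n₀ congruence)
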